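{- Let $n\in\mathbb N$ and $b=n^2+1$. Then for every $m\in\{2,3,\dots,n\}$, the number $(m\cdot n)^2$ is antipalindromic in base $b$.
   Context: For $b\in\mathbb N$, $b\ge2$, write a natural number $x$ in base $b$ as $x=a_tb^t+\dots+a_1b+a_0$ with digits $a_i\in\{0,1,\dots,b-1\}$ and $a_t\neq 0$. The number $x$ is called antipalindromic in base $b$ if $a_j=b-1-a_{t-j}$ for all $j\in\{0,1,\dots,t\}$. -}

module Defs where

open import Data.Nat using (ℕ; zero; suc; _+_; _*_; _∸_; _^_; _<_)
open import Data.Fin using (Fin; toℕ; opposite)
import Data.Fin
open import Data.Product using (Σ; _×_)
open import Relation.Binary.PropositionalEquality using (_≡_; _≢_)

value : (b : ℕ) → (t : ℕ) → (Fin (suc t) → ℕ) → ℕ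
value b zero    a = a Fin.zero
value b (suc t) a = a Fin.zero + b * value b t (λ i → a (Fin.suc i))

IsBaseRep : (b x t : ℕ) → (Fin (suc t) → ℕ) → Set
IsBaseRep b x t a =
  ((i : Fin (suc t)) → a i < b) × (a (Data.Fin.fromℕ t) ≢ 0) × (value b t a ≡ x)

-- antipalindromic: the base-b representation satisfies a_j = b-1-a_{t-j} for all j
-- (opposite j = t - j in Fin (suc t)). Representations are unique, so ∃ is faithful.
Antipalindromic : (b x : ℕ) → Set
Antipalindromic b x =
  Σ ℕ λ t → Σ (Fin (suc t) → ℕ) λ a →
    IsBaseRep b x t a × ((j : Fin (suc t)) → a j ≡ (b ∸ 1) ∸ a (opposite j))

-- With N = n² and c = m², the number (mn)² = cN equals (c − 1)(N + 1) + (N + 1 − c): two digits in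
-- base N + 1 whose sum is N, the largest digit, so they are complementary.
module Submission where

open import Defs
open import Data.Nat using (ℕ; suc; _+_; _*_; _^_; _≤_; _<_; _∸_; s≤s; z≤n)
open import Data.Nat.Properties
  using (m≤m+n; m≤n+m; m+n∸n≡m; m+n∸m≡n; ≤-trans; ^-monoˡ-≤; m≤n⇒∃[o]m+o≡n;
         +-*-commutativeSemiring)
open import Algebra.Properties.CommutativeSemiring.Exp +-*-commutativeSemiring using (^-distrib-*)
open import Data.Nat.Tactic.RingSolver using (solve-∀)
open import Data.Fin using (Fin; zero; suc; opposite)
open import Data.Product using (_,_)
open import Relation.Binary.PropositionalEquality using (_≡_; _≢_; refl; sym; subst; subst₂)

twoDigit-antipalindromic : ∀ a₀ a₁ → a₁ ≢ 0 →
  Antipalindromic (suc (a₀ + a₁)) (a₀ + suc (a₀ + a₁) * a₁)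
twoDigit-antipalindromic a₀ a₁ a₁≢0 = 1 , digit , (digit<base , a₁≢0 , refl) , complementary
  where
  digit : Fin 2 → ℕ
  digit zero    = a₀
  digit (suc _) = a₁

  digit<base : ∀ i → digit i < suc (a₀ + a₁)
  digit<base zero    = s≤s (m≤m+n a₀ a₁)
  digit<base (suc _) = s≤s (m≤n+m a₁ a₀)

  complementary : ∀ j → digit j ≡ (a₀ + a₁) ∸ digit (opposite j)
  complementary zero       = sym (m+n∸n≡m a₀ a₁)
  complementary (suc zero) = sym (m+n∸m≡n a₀ a₁)

*-antipalindromic : ∀ {c N} → 2 ≤ c → c ≤ N → Antipalindromic (N + 1) (c * N)
*-antipalindromic {suc (suc k)} (s≤s (s≤s z≤n)) c≤N with m≤n⇒∃[o]m+o≡n c≤N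
... | e , refl =
  subst₂ Antipalindromic (base≡ k e) (value≡ k e) (twoDigit-antipalindromic (suc e) (suc k) λ ())
  where
  base≡ : ∀ i j → suc (suc j + suc i) ≡ suc (suc i) + j + 1
  base≡ = solve-∀

  value≡ : ∀ i j → suc j + suc (suc j + suc i) * suc i ≡ suc (suc i) * (suc (suc i) + j)
  value≡ = solve-∀

mainTheorem10 : (n : ℕ) → (m : ℕ) → 2 ≤ m → m ≤ n →
    Antipalindromic (n ^ 2 + 1) ((m * n) ^ 2)
mainTheorem10 n m 2≤m m≤n =
  subst (Antipalindromic (n ^ 2 + 1)) (sym (^-distrib-* m n 2))
    (*-antipalindromic (≤-trans (s≤s (s≤s z≤n)) (^-monoˡ-≤ 2 2≤m)) (^-monoˡ-≤ 2 m≤n))
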